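{- Let $k\ge 3$, $n\ge\max(3,k)$ and $t$ be integers with $3\le t\le k!$. Then \[ f_k(n,t)\ \ge\ \log\log(n-1)-\log\log(k-1)+t-3 . \]
   Context: Logarithms are base 2. $S_n$ is the set of permutations of $[n]$, viewed as linear orderings of $[n]$. For $P\in S_n$ and a $k$-element $X\subseteq[n]$, $P_X\in S_k$ is the pattern (relative order) of $X$ in $P$. A family $\mathcal S\subseteq S_n$ partially shatters $X$ with $t$ orders if $|\{P_X:P\in\mathcal S\}|\ge t$. For $n\ge k$ and $1\le t\le k!$, $f_k(n,t)$ is the smallest size of a family $\mathcal S\subseteq S_n$ that partially shatters every $k$-element subset of $[n]$ with $t$ orders. -}

module Defs where

open import Data.Nat using (ℕ; zero; suc; _+_; _∸_; _^_; _≤_; _<_)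
open import Data.Fin using (Fin; toℕ) renaming (_<_ to _<ᶠ_)
open import Data.Fin.Properties using (_<?_)
open import Data.List using (List; length; filter)
open import Data.List using () renaming (allFin to allFinL)
open import Data.Product using (Σ; ∃; _×_)
open import Data.Sum using (_⊎_)
open import Relation.Binary.PropositionalEquality using (_≡_)

-- A permutation P ∈ S_n, viewed as a linear ordering of [n] = Fin n:
-- it is given by its (injective, hence bijective) rank function
-- r : Fin n → Fin n ; x comes before y in P iff r x < r y.
IsPerm : (n : ℕ) → (Fin n → Fin n) → Set
IsPerm n r = ∀ x y → r x ≡ r y → x ≡ y

-- A k-element subset X ⊆ [n], given by its increasing enumeration
-- e : Fin k → Fin n (x_1 < … < x_k).  Every k-subset has exactly one.
IsKSubset : (k n : ℕ) → (Fin k → Fin n) → Set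
IsKSubset k n e = ∀ i j → i <ᶠ j → e i <ᶠ e j

pattern′ : {k n : ℕ} → (Fin n → Fin n) → (Fin k → Fin n) → Fin k → ℕ
pattern′ {k} r e i = length (filter (λ j → r (e j) <? r (e i)) (allFinL k))

IsFamily : (n m : ℕ) → (Fin m → Fin n → Fin n) → Set
IsFamily n m S = (∀ a → IsPerm n (S a)) × (∀ a b → (∀ x → S a x ≡ S b x) → a ≡ b)

-- S partially shatters X (enumerated by e) with t orders:
-- |{P_X : P ∈ S}| ≥ t, i.e. there are t members of S with pairwise
-- distinct patterns on X.
PartShatters : {k n m : ℕ} → (t : ℕ) → (Fin m → Fin n → Fin n) → (Fin k → Fin n) → Set
PartShatters {m = m} t S e =
  Σ (Fin t → Fin m) λ g → ∀ i j → (∀ l → pattern′ (S (g i)) e l ≡ pattern′ (S (g j)) e l) → i ≡ j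

PartShattersAll : (k n t m : ℕ) → (Fin m → Fin n → Fin n) → Set
PartShattersAll k n t m S = ∀ (e : Fin k → Fin n) → IsKSubset k n e → PartShatters t S e

-- Integer-exact form of the real inequality
--   s ≥ log log (n-1) − log log (k-1) + t − 3      (logs base 2, k,n ≥ 3).
-- With d = s + 3 − t:  if d ≥ 0 it is  n-1 ≤ (k-1)^(2^d);
-- if d = −e < 0 it is  (n-1)^(2^e) ≤ k-1.
LogLogBound : (n k t s : ℕ) → Set
LogLogBound n k t s =
  (t ≤ s + 3 × n ∸ 1 ≤ (k ∸ 1) ^ (2 ^ (s + 3 ∸ t)))
  ⊎ (s + 3 < t × (n ∸ 1) ^ (2 ^ (t ∸ (s + 3))) ≤ k ∸ 1)

-- Put d = m + 3 - t.  If n - 1 > (k-1)^(2^d), then d rounds of Erdős–Szekeres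
-- (each one halving the exponent of the length bound) leave k points of [n] on
-- which each of the first d permutations of the family is increasing or
-- decreasing.  On these k points those d permutations show only two patterns,
-- so the whole family shows at most 2 + (m - d) = t - 1 patterns, and the k-set
-- is not partially shattered with t orders.

{-# OPTIONS --safe #-}
module Submission where

open import Defs
open import Data.Nat using (ℕ; _≤_)
open import Data.Nat using (_!)
open import Data.Fin using (Fin)

open import Data.Nat using (suc; _+_; _*_; _∸_; _^_; _<_; _>_; _≟_; _≤?_; _<?_; s≤s)
open import Data.Nat.Properties
  using (≤-trans; ≤-reflexive; ≤-pred; <-trans; <-irrefl; <-cmp; <-≤-trans; ≤∧≢⇒<; ≰⇒>; ≮⇒≥; <⇒≱;
         +-assoc; +-comm; +-suc; +-identityʳ; *-identityʳ; +-monoˡ-≤; +-cancelˡ-<; +-cancelʳ-≡;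
         ^-distribˡ-+-*; ∸-monoˡ-<; ∸-monoʳ-≤; m≤m+n; m∸n≤m; m+n∸n≡m; m∸n+n≡m; m+[n∸m]≡n; m≤n+m∸n;
         module ≤-Reasoning)
open import Data.Fin as Fin using (toℕ)
import Data.Fin.Properties as Fin
open import Data.List as List using (List; []; _∷_; length; map; filter; lookup)
open import Data.List.Properties using (length-map; length-tabulate; filter-≐)
open import Data.List.Extrema.Nat using (argmax; argmax-all; f[xs]≤f[argmax])
open import Data.List.Membership.Propositional.Properties using (∈-lookup)
open import Data.List.Relation.Unary.All as All using (All; []; _∷_)
import Data.List.Relation.Unary.All.Properties as All
open import Data.List.Relation.Unary.Any using (any?)
open import Data.List.Relation.Unary.AllPairs using (AllPairs; []; _∷_)
import Data.List.Relation.Unary.AllPairs as AllPairs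
import Data.List.Relation.Unary.AllPairs.Properties as AllPairs
open import Data.List.Relation.Binary.Sublist.Propositional using (_⊆_; []; _∷_; _∷ʳ_; ⊆-refl; ⊆-trans)
import Data.List.Relation.Binary.Sublist.Propositional.Properties as Sublist
open import Data.Product as Product using (∃; _×_; _,_; proj₁; proj₂; uncurry)
open import Data.Sum as Sum using (_⊎_; inj₁; inj₂)
open import Data.Sum.Properties using (inj₁-injective; inj₂-injective)
open import Function using (_∘_; flip; id)
open import Level using (0ℓ)
open import Relation.Binary
  using (Rel; Transitive; Decidable; Irreflexive; Asymmetric; _Preserves_⟶_; tri<; tri≈; tri>)
open import Relation.Binary.PropositionalEquality
  using (_≡_; _≢_; refl; sym; trans; cong; subst; subst₂; module ≡-Reasoning)
open import Relation.Nullary using (Dec; yes; no; contradiction; ¬?)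
open import Relation.Unary using (Pred)
import Relation.Unary as U

private variable
  A B : Set

∸-cancelʳ-≡ : ∀ {m n o} → o ≤ m → o ≤ n → m ∸ o ≡ n ∸ o → m ≡ n
∸-cancelʳ-≡ {m} {n} {o} o≤m o≤n eq = begin
  m          ≡⟨ m∸n+n≡m o≤m ⟨
  m ∸ o + o  ≡⟨ cong (_+ o) eq ⟩
  n ∸ o + o  ≡⟨ m∸n+n≡m o≤n ⟩
  n          ∎
  where open ≡-Reasoning

^2^-suc : ∀ K d → K ^ 2 ^ suc d ≡ K ^ 2 ^ d * K ^ 2 ^ d
^2^-suc K d = begin
  K ^ (2 ^ d + (2 ^ d + 0))  ≡⟨ cong (λ e → K ^ (2 ^ d + e)) (+-identityʳ (2 ^ d)) ⟩
  K ^ (2 ^ d + 2 ^ d)        ≡⟨ ^-distribˡ-+-* K (2 ^ d) (2 ^ d) ⟩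
  K ^ 2 ^ d * K ^ 2 ^ d      ∎
  where open ≡-Reasoning

inject≤-mono : ∀ {k n} (k≤n : k ≤ n) {i j : Fin k} → i Fin.< j → Fin.inject≤ i k≤n Fin.< Fin.inject≤ j k≤n
inject≤-mono k≤n {i} {j} = subst₂ _<_ (sym (Fin.toℕ-inject≤ i k≤n)) (sym (Fin.toℕ-inject≤ j k≤n))

AllPairs-resp-⊆ : ∀ {R : Rel A 0ℓ} {xs ys} → xs ⊆ ys → AllPairs R ys → AllPairs R xs
AllPairs-resp-⊆ []           []         = []
AllPairs-resp-⊆ (_ ∷ʳ xs⊆ys) (_ ∷ Rys)  = AllPairs-resp-⊆ xs⊆ys Rys
AllPairs-resp-⊆ (refl ∷ xs⊆ys) (Ry ∷ Rys) = Sublist.All-resp-⊆ xs⊆ys Ry ∷ AllPairs-resp-⊆ xs⊆ys Rys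

AllPairs-lookup : ∀ {R : Rel A 0ℓ} {xs} → AllPairs R xs → lookup xs Preserves Fin._<_ ⟶ R
AllPairs-lookup (Rx ∷ _)  {Fin.zero}  {Fin.suc j} _         = All.lookup Rx (∈-lookup j)
AllPairs-lookup (_ ∷ Rxs) {Fin.suc i} {Fin.suc j} (s≤s i<j) = AllPairs-lookup Rxs i<j

All-filter⇒All-implies : ∀ {P Q : Pred A 0ℓ} (P? : U.Decidable P) {xs} →
                         All Q (filter P? xs) → All (λ x → P x → Q x) xs
All-filter⇒All-implies P? {xs} Qs =
  All.filter⁻ P? (All.map (λ Qx _ → Qx) Qs)
                 (All.map (λ ¬Px Px → contradiction Px ¬Px) (All.all-filter (¬? ∘ P?) xs))

length-filter-¬ : ∀ {P : Pred A 0ℓ} (P? : U.Decidable P) xs →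
                  length (filter P? xs) + length (filter (¬? ∘ P?) xs) ≡ length xs
length-filter-¬ P? []       = refl
length-filter-¬ P? (x ∷ xs) with P? x
... | yes _ = cong suc (length-filter-¬ P? xs)
... | no _  = trans (+-suc _ _) (cong suc (length-filter-¬ P? xs))

module _ (colour : B → ℕ) where

  Monochromatic : List B → Set
  Monochromatic = AllPairs (λ p q → colour p ≡ colour q)

  private
    colour≡? : ∀ c p → Dec (colour p ≡ c)
    colour≡? c p = colour p ≟ c

    monochromatic : ∀ {c ps} → All (λ p → colour p ≡ c) ps → Monochromatic ps
    monochromatic []           = []
    monochromatic (p≡c ∷ ps≡c) = All.map (λ q≡c → trans p≡c (sym q≡c)) ps≡c ∷ monochromatic ps≡c

  pigeonhole : ∀ a b ps → All (λ p → colour p < a) ps → a * b < length ps →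
               ∃ λ qs → qs ⊆ ps × b < length qs × Monochromatic qs
  pigeonhole 0       b (p ∷ ps) (() ∷ _) _
  pigeonhole (suc a) b ps ps<1+a ab<∣ps∣ with b <? length (filter (colour≡? a) ps)
  ... | yes b<∣same∣ = _ , Sublist.filter-⊆ _ ps , b<∣same∣ , monochromatic (All.all-filter (colour≡? a) ps)
  ... | no b≮∣same∣ =
    let qs , qs⊆others , b<∣qs∣ , mono = pigeonhole a b others others<a ab<∣others∣
    in qs , ⊆-trans qs⊆others (Sublist.filter-⊆ _ ps) , b<∣qs∣ , mono
    where
    others : List B
    others = filter (¬? ∘ colour≡? a) ps

    others<a : All (λ p → colour p < a) others
    others<a = All.zipWith (λ (p<1+a , p≢a) → ≤∧≢⇒< (≤-pred p<1+a) p≢a)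
                 (All.filter⁺ (¬? ∘ colour≡? a) ps<1+a , All.all-filter (¬? ∘ colour≡? a) ps)

    ab<∣others∣ : a * b < length others
    ab<∣others∣ = +-cancelˡ-< b _ _ (begin-strict
      b + a * b                                        <⟨ ab<∣ps∣ ⟩
      length ps                                        ≡⟨ length-filter-¬ (colour≡? a) ps ⟨
      length (filter (colour≡? a) ps) + length others  ≤⟨ +-monoˡ-≤ (length others) (≮⇒≥ b≮∣same∣) ⟩
      b + length others                                ∎)
      where open ≤-Reasoning

-- An entry (x , c) of longestChains xs encodes the R-chain x ∷ c, a longest
-- R-chain in the suffix of xs that starts at x.
module LongestChains {R : Rel A 0ℓ} (R? : Decidable R) (R-trans : Transitive R) where

  extension : A → List (A × List A) → List A
  extension x cs = argmax length [] (map (uncurry _∷_) (filter (R? x ∘ proj₁) cs))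

  longestChains : List A → List (A × List A)
  longestChains []       = []
  longestChains (x ∷ xs) = (x , extension x (longestChains xs)) ∷ longestChains xs

  map-proj₁-longestChains : ∀ xs → map proj₁ (longestChains xs) ≡ xs
  map-proj₁-longestChains []       = refl
  map-proj₁-longestChains (x ∷ xs) = cong (x ∷_) (map-proj₁-longestChains xs)

  ChainIn : List A → A × List A → Set
  ChainIn xs (x , c) = x ∷ c ⊆ xs × AllPairs R (x ∷ c)

  longestChains-chains : ∀ xs → All (ChainIn xs) (longestChains xs)
  longestChains-chains []       = []
  longestChains-chains (x ∷ xs) = longest ∷ All.map (λ (c⊆xs , Rc) → x ∷ʳ c⊆xs , Rc) chains
    where
    chains : All (ChainIn xs) (longestChains xs)
    chains = longestChains-chains xs

    extend : ∀ {(y , d) : A × List A} → ChainIn xs (y , d) → R x y → ChainIn (x ∷ xs) (x , y ∷ d)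
    extend (yd⊆xs , Ryd@(Ry ∷ _)) Rxy = refl ∷ yd⊆xs , (Rxy ∷ All.map (R-trans Rxy) Ry) ∷ Ryd

    longest : ChainIn (x ∷ xs) (x , extension x (longestChains xs))
    longest = argmax-all length {P = λ c → ChainIn (x ∷ xs) (x , c)}
      (refl ∷ Sublist.[]⊆-universal xs , [] ∷ [])
      (All.map⁺ (All.zipWith (uncurry extend)
        (All.filter⁺ (R? x ∘ proj₁) chains , All.all-filter (R? x ∘ proj₁) (longestChains xs))))

  longestChains-longest : ∀ xs →
                          AllPairs (λ (x , c) (y , d) → R x y → length d < length c) (longestChains xs)
  longestChains-longest []       = []
  longestChains-longest (x ∷ xs) =
    All-filter⇒All-implies (R? x ∘ proj₁) {longestChains xs} (All.map⁻ (f[xs]≤f[argmax] {f = length} [] _))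
    ∷ longestChains-longest xs

module ErdősSzekeres {R R′ : Rel A 0ℓ} (R? : Decidable R) (R-trans : Transitive R) where
  open LongestChains R? R-trans

  -- If no R-chain is longer than a, colour each point by the length of the
  -- longest R-chain starting there: R x y forces different colours, so every
  -- colour class is an R′-chain.
  erdős-szekeres : ∀ a b xs → AllPairs (λ x y → R x y ⊎ R′ x y) xs → a * b < length xs →
                   ∃ λ ys → ys ⊆ xs × (a < length ys × AllPairs R ys ⊎ b < length ys × AllPairs R′ ys)
  erdős-szekeres a b xs R⊎R′ ab<∣xs∣ with any? (λ (_ , c) → a ≤? length c) (longestChains xs)
  ... | yes long =
    let (x∷c⊆xs , Rx∷c) , a≤∣c∣ = All.lookupAny (longestChains-chains xs) long
    in _ , x∷c⊆xs , inj₁ (s≤s a≤∣c∣ , Rx∷c)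
  ... | no ¬long =
    let qs , qs⊆cs , b<∣qs∣ , mono = pigeonhole (length ∘ proj₂) a b cs short ab<∣cs∣
    in map proj₁ qs
     , subst (map proj₁ qs ⊆_) (map-proj₁-longestChains xs) (Sublist.map⁺ proj₁ qs⊆cs)
     , inj₂ ( subst (b <_) (sym (length-map proj₁ qs)) b<∣qs∣
            , AllPairs.map⁺ (AllPairs.zipWith (λ {p} {q} → R′-if-equal {p} {q})
                                (mono , AllPairs-resp-⊆ qs⊆cs coloured)))
    where
    cs : List (A × List A)
    cs = longestChains xs

    short : All (λ (_ , c) → length c < a) cs
    short = All.map ≰⇒> (All.¬Any⇒All¬ cs ¬long)

    ab<∣cs∣ : a * b < length cs
    ab<∣cs∣ = subst (a * b <_) (trans (cong length (sym (map-proj₁-longestChains xs))) (length-map proj₁ cs))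
                    ab<∣xs∣

    coloured : AllPairs (λ (x , c) (y , d) → (R x y ⊎ R′ x y) × (R x y → length d < length c)) cs
    coloured = AllPairs.zip ( AllPairs.map⁻ (subst (AllPairs _) (sym (map-proj₁-longestChains xs)) R⊎R′)
                            , longestChains-longest xs)

    R′-if-equal : ∀ {p q : A × List A} → let (x , c) = p; (y , d) = q in
                  length c ≡ length d × (R x y ⊎ R′ x y) × (R x y → length d < length c) → R′ x y
    R′-if-equal (∣c∣≡∣d∣ , inj₁ Rxy , longer) = contradiction (longer Rxy) (<-irrefl (sym ∣c∣≡∣d∣))
    R′-if-equal (_       , inj₂ R′xy , _)     = R′xy

module _ (f : A → ℕ) where

  Monotone : List A → Set
  Monotone ys = AllPairs (λ x y → f x < f y) ys ⊎ AllPairs (λ x y → f x > f y) ys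

  Monotone-resp-⊆ : ∀ {xs ys} → ys ⊆ xs → Monotone xs → Monotone ys
  Monotone-resp-⊆ ys⊆xs = Sum.map (AllPairs-resp-⊆ ys⊆xs) (AllPairs-resp-⊆ ys⊆xs)

  monotone-sublist : ∀ q xs → AllPairs (λ x y → f x ≢ f y) xs → q * q < length xs →
                     ∃ λ ys → ys ⊆ xs × q < length ys × Monotone ys
  monotone-sublist q xs distinct qq<∣xs∣ =
    let ys , ys⊆xs , long = erdős-szekeres q q xs (AllPairs.map <⊎> distinct) qq<∣xs∣
    in ys , ys⊆xs , Sum.[ Product.map₂ inj₁ , Product.map₂ inj₂ ]′ long
    where
    open ErdősSzekeres {R = λ x y → f x < f y} {R′ = λ x y → f x > f y} (λ x y → f x <? f y) <-trans

    <⊎> : ∀ {x y} → f x ≢ f y → f x < f y ⊎ f x > f y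
    <⊎> {x} {y} fx≢fy with <-cmp (f x) (f y)
    ... | tri< fx<fy _ _ = inj₁ fx<fy
    ... | tri≈ _ fx≡fy _ = contradiction fx≡fy fx≢fy
    ... | tri> _ _ fx>fy = inj₂ fx>fy

common-monotone-sublist : ∀ K d (f : Fin d → A → ℕ) xs → (∀ i → AllPairs (λ x y → f i x ≢ f i y) xs) →
                          K ^ 2 ^ d < length xs → ∃ λ ys → ys ⊆ xs × K < length ys × ∀ i → Monotone (f i) ys
common-monotone-sublist K 0 f xs _ K<∣xs∣ =
  xs , ⊆-refl , subst (_< length xs) (*-identityʳ K) K<∣xs∣ , λ ()
common-monotone-sublist K (suc d) f xs distinct big
  with ys , ys⊆xs , q<∣ys∣ , mono₀ ← monotone-sublist (f Fin.zero) (K ^ 2 ^ d) xs (distinct Fin.zero)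
                                       (subst (_< length xs) (^2^-suc K d) big)
  with zs , zs⊆ys , K<∣zs∣ , mono ← common-monotone-sublist K d (f ∘ Fin.suc) ys
                                       (λ i → AllPairs-resp-⊆ ys⊆xs (distinct (Fin.suc i))) q<∣ys∣
  = zs , ⊆-trans zs⊆ys ys⊆xs , K<∣zs∣ ,
    λ { Fin.zero → Monotone-resp-⊆ (f Fin.zero) zs⊆ys mono₀ ; (Fin.suc i) → mono i }

SamePattern : ∀ {k n} → (Fin k → Fin n) → (r r′ : Fin n → Fin n) → Set
SamePattern e r r′ = ∀ l → pattern′ r e l ≡ pattern′ r′ e l

pattern′-cong : ∀ {k n} (e : Fin k → Fin n) {r r′ : Fin n → Fin n} →
                (∀ {i j} → r (e i) Fin.< r (e j) → r′ (e i) Fin.< r′ (e j)) →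
                (∀ {i j} → r′ (e i) Fin.< r′ (e j) → r (e i) Fin.< r (e j)) →
                SamePattern e r r′
pattern′-cong {k} e to from l = cong length (filter-≐ _ _ (to , from) (List.allFin k))

module _ {k : ℕ} {_≺_ : Rel B 0ℓ} (≺-irrefl : Irreflexive _≡_ _≺_) (≺-asym : Asymmetric _≺_) where

  monotone-reflects : ∀ {h h′ : Fin k → B} → h Preserves Fin._<_ ⟶ _≺_ → h′ Preserves Fin._<_ ⟶ _≺_ →
                      ∀ {i j} → h i ≺ h j → h′ i ≺ h′ j
  monotone-reflects {h} {h′} h-mono h′-mono {i} {j} hi≺hj with Fin.<-cmp i j
  ... | tri< i<j _ _  = h′-mono i<j
  ... | tri≈ _ refl _ = contradiction hi≺hj (≺-irrefl refl)
  ... | tri> _ _ j<i  = contradiction hi≺hj (≺-asym (h-mono j<i))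

data MonotoneOn {k n} (e : Fin k → Fin n) (r : Fin n → Fin n) : Set where
  increasing : (r ∘ e) Preserves Fin._<_ ⟶ Fin._<_ → MonotoneOn e r
  decreasing : (r ∘ e) Preserves Fin._<_ ⟶ flip Fin._<_ → MonotoneOn e r

direction : ∀ {k n} {e : Fin k → Fin n} {r} → MonotoneOn e r → Fin 2
direction (increasing _) = Fin.zero
direction (decreasing _) = Fin.suc Fin.zero

same-direction⇒same-pattern : ∀ {k n} {e : Fin k → Fin n} {r r′}
                              (mono : MonotoneOn e r) (mono′ : MonotoneOn e r′) →
                              direction mono ≡ direction mono′ → SamePattern e r r′
same-direction⇒same-pattern {e = e} {r} {r′} (increasing inc) (increasing inc′) _ =
  pattern′-cong e {r} {r′} (monotone-reflects Fin.<-irrefl Fin.<-asym inc inc′)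
                           (monotone-reflects Fin.<-irrefl Fin.<-asym inc′ inc)
same-direction⇒same-pattern {e = e} {r} {r′} (decreasing dec) (decreasing dec′) _ =
  pattern′-cong e {r} {r′} (monotone-reflects (Fin.<-irrefl ∘ sym) Fin.<-asym dec dec′)
                           (monotone-reflects (Fin.<-irrefl ∘ sym) Fin.<-asym dec′ dec)
same-direction⇒same-pattern (increasing _) (decreasing _) ()
same-direction⇒same-pattern (decreasing _) (increasing _) ()

shatters⇒≤ : ∀ {k n m t q} {S : Fin m → Fin n → Fin n} {e : Fin k → Fin n} → PartShatters t S e →
             (c : Fin m → Fin q) → (∀ {a b} → c a ≡ c b → SamePattern e (S a) (S b)) → t ≤ q
shatters⇒≤ (g , g-distinct) c c-sound = Fin.injective⇒≤ (λ cga≡cgb → g-distinct _ _ (c-sound cga≡cgb))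

shattersAll⇒t≤m : ∀ {k n t m} {S : Fin m → Fin n → Fin n} → k ≤ n → PartShattersAll k n t m S → t ≤ m
shattersAll⇒t≤m {k} {n} {S = S} k≤n shatters =
  shatters⇒≤ {S = S} {e} (shatters e (λ _ _ → inject≤-mono k≤n)) id (λ { refl _ → refl })
  where
  e : Fin k → Fin n
  e i = Fin.inject≤ i k≤n

module _ {k n m d} {S : Fin m → Fin n → Fin n} {e : Fin k → Fin n}
         (mono : ∀ a → toℕ a < d → MonotoneOn e (S a)) where

  private
    classify : Fin m → Fin 2 ⊎ Fin (m ∸ d)
    classify a with toℕ a <? d
    ... | yes a<d = inj₁ (direction (mono a a<d))
    ... | no a≮d  = inj₂ (Fin.fromℕ< (∸-monoˡ-< (Fin.toℕ<n a) (≮⇒≥ a≮d)))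

    classify-sound : ∀ a b → classify a ≡ classify b → SamePattern e (S a) (S b)
    classify-sound a b eq with toℕ a <? d | toℕ b <? d
    classify-sound a b eq | yes a<d | yes b<d =
      same-direction⇒same-pattern (mono a a<d) (mono b b<d) (inj₁-injective eq)
    classify-sound a b eq | no a≮d | no b≮d
      with refl ← Fin.toℕ-injective (∸-cancelʳ-≡ (≮⇒≥ a≮d) (≮⇒≥ b≮d)
                    (Fin.fromℕ<-injective _ _ _ _ (inj₂-injective eq))) = λ _ → refl
    classify-sound a b () | yes _ | no _
    classify-sound a b () | no _  | yes _

    join-injective : ∀ {x y} → Fin.join 2 (m ∸ d) x ≡ Fin.join 2 (m ∸ d) y → x ≡ y
    join-injective {x} {y} eq = begin
      x                                     ≡⟨ Fin.splitAt-join 2 (m ∸ d) x ⟨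
      Fin.splitAt 2 (Fin.join 2 (m ∸ d) x)  ≡⟨ cong (Fin.splitAt 2) eq ⟩
      Fin.splitAt 2 (Fin.join 2 (m ∸ d) y)  ≡⟨ Fin.splitAt-join 2 (m ∸ d) y ⟩
      y                                     ∎
      where open ≡-Reasoning

  few-patterns : ∀ {t} → PartShatters t S e → t ≤ 2 + (m ∸ d)
  few-patterns shatters =
    shatters⇒≤ {S = S} {e} shatters (Fin.join 2 (m ∸ d) ∘ classify) (classify-sound _ _ ∘ join-injective)

kSubset-of-sublist : ∀ {k n} {ys : List (Fin n)} → ys ⊆ List.allFin n → k ≤ length ys →
                     ∃ λ e → IsKSubset k n e × ∀ {r} → Monotone (toℕ ∘ r) ys → MonotoneOn e r
kSubset-of-sublist {k} {n} {ys} ys⊆[n] k≤∣ys∣ =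
  e , (λ _ _ → along (AllPairs-resp-⊆ ys⊆[n] (AllPairs.tabulate⁺-< id))) ,
  λ { (inj₁ inc) → increasing (along inc) ; (inj₂ dec) → decreasing (along dec) }
  where
  e : Fin k → Fin n
  e i = lookup ys (Fin.inject≤ i k≤∣ys∣)

  along : ∀ {R : Rel (Fin n) 0ℓ} → AllPairs R ys → e Preserves Fin._<_ ⟶ R
  along Rys = AllPairs-lookup Rys ∘ inject≤-mono k≤∣ys∣

module _ {n m d} {S : Fin m → Fin n → Fin n} (perm : ∀ a → IsPerm n (S a)) (d≤m : d ≤ m) where

  private
    f : Fin d → Fin n → ℕ
    f i x = toℕ (S (Fin.inject≤ i d≤m) x)

    distinct : ∀ i → AllPairs (λ x y → f i x ≢ f i y) (List.allFin n)
    distinct i = AllPairs.tabulate⁺ (λ x≢y fx≡fy → x≢y (perm _ _ _ (Fin.toℕ-injective fx≡fy)))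

    inject≤-fromℕ< : ∀ {a} (a<d : toℕ a < d) → Fin.inject≤ (Fin.fromℕ< a<d) d≤m ≡ a
    inject≤-fromℕ< a<d = Fin.toℕ-injective (trans (Fin.toℕ-inject≤ _ d≤m) (Fin.toℕ-fromℕ< a<d))

  monotone-kSubset : ∀ {k} → (k ∸ 1) ^ 2 ^ d < n →
                     ∃ λ e → IsKSubset k n e × ∀ a → toℕ a < d → MonotoneOn e (S a)
  monotone-kSubset {k} big
    with ys , ys⊆[n] , k-1<∣ys∣ , mono ← common-monotone-sublist (k ∸ 1) d f (List.allFin n) distinct
                                           (subst ((k ∸ 1) ^ 2 ^ d <_) (sym (length-tabulate id)) big)
    with e , e-subset , e-mono ← kSubset-of-sublist ys⊆[n] (≤-trans (m≤n+m∸n k 1) k-1<∣ys∣)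
    = e , e-subset ,
      λ a a<d → e-mono (subst (λ a → Monotone (toℕ ∘ S a) ys) (inject≤-fromℕ< a<d) (mono (Fin.fromℕ< a<d)))

m+3∸t≤m : ∀ m {t} → 3 ≤ t → m + 3 ∸ t ≤ m
m+3∸t≤m m {t} 3≤t = subst (m + 3 ∸ t ≤_) (m+n∸n≡m m 3) (∸-monoʳ-≤ (m + 3) 3≤t)

2+[m∸[m+3∸t]]<t : ∀ m {t} → 3 ≤ t → t ≤ m + 3 → 2 + (m ∸ (m + 3 ∸ t)) < t
2+[m∸[m+3∸t]]<t m {t} 3≤t t≤m+3 = ≤-reflexive (+-cancelʳ-≡ d _ _ (begin
  3 + (m ∸ d) + d  ≡⟨ +-assoc 3 (m ∸ d) d ⟩
  3 + (m ∸ d + d)  ≡⟨ cong (3 +_) (m∸n+n≡m (m+3∸t≤m m 3≤t)) ⟩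
  3 + m            ≡⟨ +-comm 3 m ⟩
  m + 3            ≡⟨ m+[n∸m]≡n t≤m+3 ⟨
  t + d            ∎))
  where
  d : ℕ
  d = m + 3 ∸ t
  open ≡-Reasoning

theorem2p5 : (k n t m : ℕ) → 3 ≤ k → 3 ≤ n → k ≤ n → 3 ≤ t → t ≤ k ! →
    (S : Fin m → Fin n → Fin n) → IsFamily n m S → PartShattersAll k n t m S →
    LogLogBound n k t m
theorem2p5 k n t m _ _ k≤n 3≤t _ S (perm , _) shatters = inj₁ (t≤m+3 , n-1≤[k-1]^2^d)
  where
  t≤m+3 : t ≤ m + 3
  t≤m+3 = ≤-trans (shattersAll⇒t≤m {S = S} k≤n shatters) (m≤m+n m 3)

  n-1≤[k-1]^2^d : n ∸ 1 ≤ (k ∸ 1) ^ 2 ^ (m + 3 ∸ t)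
  n-1≤[k-1]^2^d = ≮⇒≥ λ big →
    let e , e-subset , e-mono = monotone-kSubset {S = S} perm (m+3∸t≤m m 3≤t) (<-≤-trans big (m∸n≤m n 1))
    in <⇒≱ (2+[m∸[m+3∸t]]<t m 3≤t t≤m+3) (few-patterns {S = S} e-mono (shatters e e-subset))
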